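{- Let $q$ be an odd prime power and let $\chi$ be the modified algebraic coloring of the complete graph on $\mathbb{F}_q^2$ defined in the context. There do not exist distinct $a,b,c,d,e\in\mathbb{F}_q^2$ with $\chi(bc)=\chi(cd)=\chi(de)$, $\chi(eb)=\chi(ba)=\chi(ad)$ and $\chi(ac)=\chi(ae)$.
   Context: Vertices are vectors $x=(x_1,x_2)\in\mathbb{F}_q^2$. For distinct $x,y$ let $\chi_1(xy)=(x_1y_1-x_2-y_2,\ \delta(x_1,y_1))$ with $\delta(x_1,y_1)=0$ if $x_1=y_1$ and $1$ otherwise (field operations in $\mathbb{F}_q$). For $\alpha\in\mathbb{F}_q$, the graph $G_\alpha$ on $\mathbb{F}_q\setminus\{\alpha\}$ with edges $\{x,y\}$, $x+y=2\alpha$, is a perfect matching; fix a partition $\mathbb{F}_q\setminus\{\alpha\}=S_\alpha\cup T_\alpha$ with each matching edge having one endpoint in each part, and for $\beta\ne\alpha$ let $f_\alpha(\beta)=S$ if $\beta\in S_\alpha$ and $T$ if $\beta\in T_\alpha$. Fix a linear order $<$ on $\mathbb{F}_q^2$. For $x<y$ with $x_1\ne y_1$ let $\chi_2(xy)=(f_{x_1}(y_1),f_{y_1}(x_1))$; when $x_1=y_1$, $\chi_2(xy)$ is some fixed value. Then $\chi(xy)=(\chi_1(xy),\chi_2(xy))$. -}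

module Defs where

open import Level using (0ℓ)
open import Data.Bool using (Bool)
open import Data.Product using (_×_; _,_; Σ)
open import Data.List using (List)
open import Data.List.Membership.Propositional using (_∈_)
open import Relation.Nullary using (¬_; Dec; yes; no)
open import Relation.Binary using (Tri; tri<; tri≈; tri>; IsStrictTotalOrder)
open import Relation.Binary.PropositionalEquality using (_≡_)
open import Algebra.Structures using (IsCommutativeRing)

-- Every finite field has prime
-- power order q; odd q corresponds to 1 + 1 ≠ 0 (characteristic ≠ 2).
record FiniteField : Set₁ where
  field
    Carrier : Set
    _+_ _*_ : Carrier → Carrier → Carrier
    -_      : Carrier → Carrier
    0# 1#   : Carrier
    isCommutativeRing : IsCommutativeRing _≡_ _+_ _*_ -_ 0# 1#
    1≢0     : ¬ (1# ≡ 0#)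
    inv     : ∀ x → ¬ (x ≡ 0#) → Σ Carrier λ y → x * y ≡ 1#
    _≟_     : (x y : Carrier) → Dec (x ≡ y)
    enum    : List Carrier
    complete : ∀ x → x ∈ enum

  _-_ : Carrier → Carrier → Carrier
  x - y = x + (- y)

  2# : Carrier
  2# = 1# + 1#

-- q odd: characteristic different from 2.
OddOrder : FiniteField → Set
OddOrder F = ¬ (FiniteField.2# F ≡ FiniteField.0# F)

module Coloring (F : FiniteField) where
  open FiniteField F

  Pt : Set
  Pt = Carrier × Carrier

  fst snd : Pt → Carrier
  fst (a , _) = a
  snd (_ , b) = b

  -- δ(x₁,y₁): false (0) if equal, true (1) otherwise
  δ : Carrier → Carrier → Bool
  δ a b with a ≟ b
  ... | yes _ = Bool.false
  ... | no  _ = Bool.true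

  χ₁ : Pt → Pt → Carrier × Bool
  χ₁ x y = ((fst x * fst y) - snd x) - snd y , δ (fst x) (fst y)

  -- f α β = true means β ∈ S_α, false means β ∈ T_α (meaningful for β ≠ α).
  -- Partition condition: every edge {β, 2α − β} of the matching G_α has one
  -- endpoint in each part.
  IsMatchingPartition : (Carrier → Carrier → Bool) → Set
  IsMatchingPartition f =
    ∀ α β → ¬ (β ≡ α) → ¬ (f α β ≡ f α ((2# * α) - β))

  -- χ₂ on an unordered pair, computed after ordering the pair by <.
  -- c₀ is the fixed value used when x₁ = y₁.
  module _ {_<_ : Pt → Pt → Set} (ord : IsStrictTotalOrder _≡_ _<_)
           (f : Carrier → Carrier → Bool) (c₀ : Bool × Bool) where
    open IsStrictTotalOrder ord using (compare)

    χ₂-ord : Pt → Pt → Bool × Bool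
    χ₂-ord x y with fst x ≟ fst y
    ... | yes _ = c₀
    ... | no  _ = (f (fst x) (fst y) , f (fst y) (fst x))

    χ₂ : Pt → Pt → Bool × Bool
    χ₂ x y with compare x y
    ... | tri< _ _ _ = χ₂-ord x y
    ... | tri≈ _ _ _ = χ₂-ord x y
    ... | tri> _ _ _ = χ₂-ord y x

    χ : Pt → Pt → (Carrier × Bool) × (Bool × Bool)
    χ x y = (χ₁ x y , χ₂ x y)

module Submission where

-- Proof idea.
--
-- View a vertex y = (y₁ , y₂) as the affine line t ↦ t·y₁ − y₂.  The first
-- component of χ₁(xy) is x₁y₁ − x₂ − y₂ = line y (x₁) − x₂, so y and z get
-- the same colour from x exactly when their lines meet above x₁.  Over a
-- field, lines meeting above two distinct points coincide, and lines of
-- equal slope meeting once coincide.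
-- For the theorem: χ(ba) = χ(ad) forces a₁ ≠ d₁ (otherwise the δ component
-- puts b in the column of a and d, whence b = d); then χ(cd) = χ(de) and
-- χ(ac) = χ(ae) say c, e get equal colours from d and from a, so c = e.

open import Defs
open import Data.Bool using (Bool; false)
open import Data.Product using (_×_; _,_; proj₁; proj₂)
open import Data.Empty using (⊥; ⊥-elim)
open import Relation.Nullary using (¬_; yes; no)
open import Relation.Binary using (IsStrictTotalOrder)
open import Relation.Binary.PropositionalEquality
  using (_≡_; refl; sym; trans; cong; cong₂; module ≡-Reasoning)
open import Algebra.Bundles using (CommutativeRing)
open import Algebra.Definitions using (AlmostLeftCancellative)
import Algebra.Properties.Group as GroupProperties
import Algebra.Properties.AbelianGroup as AbelianGroupProperties
import Algebra.Properties.CommutativeSemigroup as CommutativeSemigroupProperties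
import Algebra.Properties.Ring as RingProperties

module AffineLines {c ℓ} (R : CommutativeRing c ℓ) where
  open CommutativeRing R
  open GroupProperties +-group using (∙-cancelˡ; ∙-cancelʳ; ⁻¹-injective; x∙y⁻¹≈ε⇒x≈y)
  open AbelianGroupProperties +-abelianGroup using (⁻¹-anti-homo‿-)
  open CommutativeSemigroupProperties +-commutativeSemigroup using (xy∙z≈xz∙y)
  open RingProperties ring using ([y-z]x≈yx-zx)
  open import Relation.Binary.Reasoning.Setoid setoid

  Point : Set c
  Point = Carrier × Carrier

  line : Point → Carrier → Carrier
  line (y₁ , y₂) t = t * y₁ - y₂

  weight : Point → Point → Carrier
  weight (x₁ , x₂) (y₁ , y₂) = (x₁ * y₁ - x₂) - y₂

  weight-via-line : ∀ x y → weight x y ≈ line y (proj₁ x) - proj₂ x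
  weight-via-line (x₁ , x₂) (y₁ , y₂) = xy∙z≈xz∙y (x₁ * y₁) (- x₂) (- y₂)

  weight-sym : ∀ x y → weight x y ≈ weight y x
  weight-sym (x₁ , x₂) (y₁ , y₂) = begin
    (x₁ * y₁ - x₂) - y₂  ≈⟨ xy∙z≈xz∙y (x₁ * y₁) (- x₂) (- y₂) ⟩
    (x₁ * y₁ - y₂) - x₂  ≈⟨ +-congʳ (+-congʳ (*-comm x₁ y₁)) ⟩
    (y₁ * x₁ - y₂) - x₂  ∎

  equal-weights⇒lines-meet : ∀ x y z → weight x y ≈ weight x z →
                             line y (proj₁ x) ≈ line z (proj₁ x)
  equal-weights⇒lines-meet x y z xy≈xz = ∙-cancelʳ (- proj₂ x) _ _ (begin
    line y (proj₁ x) - proj₂ x  ≈⟨ weight-via-line x y ⟨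
    weight x y                  ≈⟨ xy≈xz ⟩
    weight x z                  ≈⟨ weight-via-line x z ⟩
    line z (proj₁ x) - proj₂ x  ∎)

  parallel-lines-meeting-coincide : ∀ {y z} t → proj₁ y ≈ proj₁ z →
                                    line y t ≈ line z t → proj₂ y ≈ proj₂ z
  parallel-lines-meeting-coincide {y₁ , y₂} {z₁ , z₂} t y₁≈z₁ meet =
    ⁻¹-injective (∙-cancelˡ (t * y₁) (- y₂) (- z₂) (begin
      t * y₁ - y₂  ≈⟨ meet ⟩
      t * z₁ - z₂  ≈⟨ +-congʳ (*-congˡ y₁≈z₁) ⟨
      t * y₁ - z₂  ∎))

  line-increment : ∀ y t s → line y t - line y s ≈ (t - s) * proj₁ y
  line-increment (y₁ , y₂) t s = begin
    (t * y₁ - y₂) - (s * y₁ - y₂)    ≈⟨ +-congˡ (⁻¹-anti-homo‿- (s * y₁) y₂) ⟩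
    (t * y₁ - y₂) + (y₂ - s * y₁)    ≈⟨ +-assoc (t * y₁) (- y₂) (y₂ - s * y₁) ⟩
    t * y₁ + (- y₂ + (y₂ - s * y₁))  ≈⟨ +-congˡ (+-assoc (- y₂) y₂ (- (s * y₁))) ⟨
    t * y₁ + ((- y₂ + y₂) - s * y₁)  ≈⟨ +-congˡ (+-congʳ (-‿inverseˡ y₂)) ⟩
    t * y₁ + (0# - s * y₁)           ≈⟨ +-congˡ (+-identityˡ (- (s * y₁))) ⟩
    t * y₁ - s * y₁                  ≈⟨ [y-z]x≈yx-zx y₁ t s ⟨
    (t - s) * y₁                     ∎

  equal-weights-in-column : ∀ x y z → proj₁ y ≈ proj₁ z →
                            weight x y ≈ weight x z → proj₂ y ≈ proj₂ z
  equal-weights-in-column x y z y₁≈z₁ xy≈xz =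
    parallel-lines-meeting-coincide (proj₁ x) y₁≈z₁ (equal-weights⇒lines-meet x y z xy≈xz)

  module _ (*-cancelˡ : AlmostLeftCancellative _≈_ 0# _*_) where

    lines-meeting-twice-are-parallel : ∀ {y z t s} → ¬ t ≈ s →
      line y t ≈ line z t → line y s ≈ line z s → proj₁ y ≈ proj₁ z
    lines-meeting-twice-are-parallel {y} {z} {t} {s} t≉s meet-t meet-s =
      *-cancelˡ (t - s) (proj₁ y) (proj₁ z) t-s≉0 (begin
        (t - s) * proj₁ y    ≈⟨ line-increment y t s ⟨
        line y t - line y s  ≈⟨ +-cong meet-t (-‿cong meet-s) ⟩
        line z t - line z s  ≈⟨ line-increment z t s ⟩
        (t - s) * proj₁ z    ∎)
      where
      t-s≉0 : ¬ (t - s) ≈ 0#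
      t-s≉0 t-s≈0 = t≉s (x∙y⁻¹≈ε⇒x≈y t s t-s≈0)

    equal-weights-from-two-columns : ∀ x u y z → ¬ proj₁ x ≈ proj₁ u →
      weight x y ≈ weight x z → weight u y ≈ weight u z →
      proj₁ y ≈ proj₁ z × proj₂ y ≈ proj₂ z
    equal-weights-from-two-columns x u y z x₁≉u₁ xy≈xz uy≈uz =
      y₁≈z₁ , equal-weights-in-column x y z y₁≈z₁ xy≈xz
      where
      y₁≈z₁ : proj₁ y ≈ proj₁ z
      y₁≈z₁ = lines-meeting-twice-are-parallel x₁≉u₁
        (equal-weights⇒lines-meet x y z xy≈xz) (equal-weights⇒lines-meet u y z uy≈uz)

module FieldColouring (F : FiniteField) where
  open FiniteField F
  open Coloring F

  commutativeRing : CommutativeRing _ _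
  commutativeRing = record { isCommutativeRing = isCommutativeRing }

  open CommutativeRing commutativeRing using (*-assoc; *-comm; *-identityˡ)
  open AffineLines commutativeRing
  open ≡-Reasoning

  *-cancelˡ-nonzero : AlmostLeftCancellative _≡_ 0# _*_
  *-cancelˡ-nonzero a x y a≢0 ax≡ay with inv a a≢0
  ... | a⁻¹ , aa⁻¹≡1 = begin
    x              ≡⟨ undo x ⟩
    a⁻¹ * (a * x)  ≡⟨ cong (a⁻¹ *_) ax≡ay ⟩
    a⁻¹ * (a * y)  ≡⟨ undo y ⟨
    y              ∎
    where
    undo : ∀ w → w ≡ a⁻¹ * (a * w)
    undo w = begin
      w              ≡⟨ *-identityˡ w ⟨
      1# * w         ≡⟨ cong (_* w) (trans (sym aa⁻¹≡1) (*-comm a a⁻¹)) ⟩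
      (a⁻¹ * a) * w  ≡⟨ *-assoc a⁻¹ a w ⟩
      a⁻¹ * (a * w)  ∎

  δ-false⇒≡ : ∀ s t → δ s t ≡ false → s ≡ t
  δ-false⇒≡ s t δ≡false with s ≟ t
  ... | yes s≡t = s≡t
  δ-false⇒≡ s t () | no _

  δ-refl : ∀ s → δ s s ≡ false
  δ-refl s with s ≟ s
  ... | yes _ = refl
  ... | no s≢s = ⊥-elim (s≢s refl)

  δ-sym : ∀ s t → δ s t ≡ δ t s
  δ-sym s t with s ≟ t | t ≟ s
  ... | yes _   | yes _   = refl
  ... | no _    | no _    = refl
  ... | yes s≡t | no t≢s  = ⊥-elim (t≢s (sym s≡t))
  ... | no s≢t  | yes t≡s = ⊥-elim (s≢t (sym t≡s))

  χ₁-sym : ∀ x y → χ₁ x y ≡ χ₁ y x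
  χ₁-sym x y = cong₂ _,_ (weight-sym x y) (δ-sym (fst x) (fst y))

  -- If x sees y and z in the same χ₁-colour and z is in the column of x,
  -- then y = z: the δ component puts y in that column too.
  same-colour-into-own-column : ∀ x y z → fst x ≡ fst z → χ₁ x y ≡ χ₁ x z → y ≡ z
  same-colour-into-own-column x y z x₁≡z₁ xy≡xz =
    cong₂ _,_ y₁≡z₁ (equal-weights-in-column x y z y₁≡z₁ (cong proj₁ xy≡xz))
    where
    δxz≡false : δ (fst x) (fst z) ≡ false
    δxz≡false = trans (cong (δ (fst x)) (sym x₁≡z₁)) (δ-refl (fst x))

    y₁≡z₁ : fst y ≡ fst z
    y₁≡z₁ = trans (sym (δ-false⇒≡ (fst x) (fst y) (trans (cong proj₂ xy≡xz) δxz≡false))) x₁≡z₁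

  same-colours-from-two-columns : ∀ x u y z → ¬ fst x ≡ fst u →
    χ₁ x y ≡ χ₁ x z → χ₁ u y ≡ χ₁ u z → y ≡ z
  same-colours-from-two-columns x u y z x₁≢u₁ xy≡xz uy≡uz
    with equal-weights-from-two-columns *-cancelˡ-nonzero x u y z x₁≢u₁
           (cong proj₁ xy≡xz) (cong proj₁ uy≡uz)
  ... | y₁≡z₁ , y₂≡z₂ = cong₂ _,_ y₁≡z₁ y₂≡z₂

open FieldColouring

lemma19 : (F : FiniteField) → OddOrder F →
    (f : FiniteField.Carrier F → FiniteField.Carrier F → Bool) →
    Coloring.IsMatchingPartition F f →
    {_<_ : Coloring.Pt F → Coloring.Pt F → Set} →
    (ord : IsStrictTotalOrder _≡_ _<_) →
    (c₀ : Bool × Bool) →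
    (a b c d e : Coloring.Pt F) →
    ¬ (a ≡ b) → ¬ (a ≡ c) → ¬ (a ≡ d) → ¬ (a ≡ e) →
    ¬ (b ≡ c) → ¬ (b ≡ d) → ¬ (b ≡ e) →
    ¬ (c ≡ d) → ¬ (c ≡ e) → ¬ (d ≡ e) →
    Coloring.χ F ord f c₀ b c ≡ Coloring.χ F ord f c₀ c d →
    Coloring.χ F ord f c₀ c d ≡ Coloring.χ F ord f c₀ d e →
    Coloring.χ F ord f c₀ e b ≡ Coloring.χ F ord f c₀ b a →
    Coloring.χ F ord f c₀ b a ≡ Coloring.χ F ord f c₀ a d →
    Coloring.χ F ord f c₀ a c ≡ Coloring.χ F ord f c₀ a e →
    ⊥
lemma19 F _ f _ ord c₀ a b c d e _ _ _ _ _ b≢d _ _ c≢e _ _ cd≡de _ ba≡ad ac≡ae =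
  c≢e (same-colours-from-two-columns F a d c e a₁≢d₁ (cong proj₁ ac≡ae) dc≡de)
  where
  open Coloring F using (fst; χ₁)

  dc≡de : χ₁ d c ≡ χ₁ d e
  dc≡de = trans (χ₁-sym F d c) (cong proj₁ cd≡de)

  -- a sees b and d in the same colour, so d cannot lie in the column of a.
  a₁≢d₁ : ¬ fst a ≡ fst d
  a₁≢d₁ a₁≡d₁ = b≢d (same-colour-into-own-column F a b d a₁≡d₁
    (trans (χ₁-sym F a b) (cong proj₁ ba≡ad)))
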